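{- There are infinitely many $n$ such that every nondeterministic OBDD on $n$ variables computing $\mathtt{NotO_n}$ has width at least $\lfloor\log n\rfloor-1$.
   Context: $\log$ denotes the logarithm base $2$. For $\nu\in\{0,1\}^n$ let $\#_0(\nu)$, $\#_1(\nu)$ be the numbers of zeros and ones in $\nu$. $\mathtt{NotO_n}(\nu)=0$ if $\#_0(\nu)=\#_1(\nu)$ and $1$ otherwise. A nondeterministic OBDD on variables $x_1,\dots,x_n$ with order $\pi$ (a permutation of $\{1,\dots,n\}$) is a leveled directed acyclic graph with levels $0,\dots,n$, a single source node at level $0$, where each node at level $j-1$ has any number of outgoing edges labelled $0$ or $1$ to nodes at level $j$, and nodes at level $n$ are accepting or rejecting. A computation path on $\nu$ starts at the source and at step $j$ follows an edge labelled $\nu_{\pi(j)}$; $\nu$ is accepted iff some computation path ends at an accepting node. The width is the maximum number of nodes in a level. -}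

module Defs where

open import Data.Nat using (ℕ; zero; suc; _+_; _⊔_; _≟_)
open import Data.Bool using (Bool; true; false; not; if_then_else_)
open import Data.Fin using (Fin; zero; suc; inject₁; fromℕ)
open import Data.Fin.Permutation using (Permutation′; _⟨$⟩ʳ_)
open import Data.Product using (Σ; _×_; _,_)
open import Relation.Nullary.Decidable using (⌊_⌋)
open import Relation.Binary.PropositionalEquality using (_≡_)
open import Function.Bundles using (_⇔_)

count : {n : ℕ} → Bool → (Fin n → Bool) → ℕ
count {zero}  b ν = 0
count {suc n} b ν =
  (if ⌊ Data.Bool._≟_ (ν zero) b ⌋ then 1 else 0) + count b (λ i → ν (suc i))

#₀ #₁ : {n : ℕ} → (Fin n → Bool) → ℕ
#₀ = count false
#₁ = count true

NotO : (n : ℕ) → (Fin n → Bool) → Bool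
NotO n ν = not ⌊ #₀ ν ≟ #₁ ν ⌋

maxF : (k : ℕ) → (Fin k → ℕ) → ℕ
maxF zero    f = 0
maxF (suc k) f = f zero ⊔ maxF k (λ i → f (suc i))

-- Level j (j = 0..n) has  size j  nodes, identified with Fin (size j).
-- edge j u b v = true  means there is an edge labelled b from node u at level j
-- to node v at level j+1.  accept marks the accepting nodes at level n.
record NOBDD (n : ℕ) : Set where
  field
    order  : Permutation′ n
    size   : Fin (suc n) → ℕ
    single-source : size zero ≡ 1
    edge   : (j : Fin n) → Fin (size (inject₁ j)) → Bool → Fin (size (suc j)) → Bool
    accept : Fin (size (fromℕ n)) → Bool

  source : Fin (size zero)
  source rewrite single-source = zero

  width : ℕ
  width = maxF (suc n) size

  record Path (ν : Fin n → Bool) : Set where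
    field
      node  : (j : Fin (suc n)) → Fin (size j)
      start : node zero ≡ source
      steps : (j : Fin n) → edge j (node (inject₁ j)) (ν (order ⟨$⟩ʳ j)) (node (suc j)) ≡ true

  Accepts : (Fin n → Bool) → Set
  Accepts ν = Σ (Path ν) λ p → accept (Path.node p (fromℕ n)) ≡ true

  Computes : ((Fin n → Bool) → Bool) → Set
  Computes f = (ν : Fin n → Bool) → Accepts ν ⇔ (f ν ≡ true)

-- Take n = k + k and cut an OBDD after the first k variables it reads.  Let ν(a,b), for
-- a, b ∈ {0,…,k}, carry a ones on the first k variables read and k − b ones on the last k;
-- it is balanced exactly when a = b.  If ν(a,b) with a ≠ b is accepted along a path through
-- the node v at the cut, then no accepting path of any ν(b,c) passes through v, since
-- pasting its first half to the second half of the former would accept the balanced ν(b,b).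
-- So the k + 1 sets of cut nodes met by accepting paths of the inputs with first half a are
-- pairwise distinct, whence 2 ^ width ≥ k + 1.  For k = 2 ^ m this is width > m = ⌊log₂ n⌋ − 1.
module Submission where

open import Defs
open import Data.Bool using (Bool; true; false; if_then_else_) renaming (_≟_ to _≟ᵇ_)
open import Data.Fin using (Fin; zero; suc; toℕ; fromℕ; fromℕ<; inject₁; splitAt; funToFin; finToFun)
open import Data.Fin.Permutation using (Permutation′; _⟨$⟩ʳ_; _⟨$⟩ˡ_; inverseˡ)
open import Data.Fin.Properties using (toℕ-injective; toℕ-fromℕ<; toℕ-fromℕ; toℕ-inject₁; toℕ≤pred[n]; splitAt-<; splitAt-≥; finToFun-funToFin; injective⇒≤)
import Data.Fin.Properties as Fin
open import Data.Nat using (ℕ; zero; suc; _+_; _∸_; _^_; _≤_; _<_; _≤?_; _<?_; _<ᵇ_; z≤n; s≤s)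
import Data.Nat as ℕ
open import Data.Nat.Logarithm using (⌊log₂_⌋; ⌊log₂[2^n]⌋≡n)
open import Data.Nat.Properties
open import Data.Product using (Σ; ∃-syntax; _×_; _,_)
open import Data.Sum using (inj₁; inj₂)
open import Data.Vec.Functional using (_++_)
open import Function using (_∘_)
open import Function.Bundles using (Equivalence)
open import Relation.Binary.PropositionalEquality using (_≡_; _≢_; refl; sym; trans; cong; cong₂; subst; module ≡-Reasoning)
open import Relation.Nullary using (¬_; Dec; yes; no; contradiction)
open import Relation.Nullary.Decidable using (⌊_⌋; decidable-stable; ¬¬-excluded-middle)
open import Algebra.Properties.CommutativeMonoid.Sum +-0-commutativeMonoid using (sum; sum-permute; sum-cong-≗)

private
  variable
    a k l m n r : ℕ

indicator : Bool → Bool → ℕ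
indicator b x = if ⌊ x ≟ᵇ b ⌋ then 1 else 0

count≡sum : ∀ b (ν : Fin n → Bool) → count b ν ≡ sum (indicator b ∘ ν)
count≡sum {zero}  b ν = refl
count≡sum {suc n} b ν = cong (indicator b (ν zero) +_) (count≡sum b (ν ∘ suc))

count-cong : ∀ b {ν ν′ : Fin n → Bool} → (∀ i → ν i ≡ ν′ i) → count b ν ≡ count b ν′
count-cong {n} b {ν} {ν′} ν≗ν′ = begin
  count b ν               ≡⟨ count≡sum b ν ⟩
  sum (indicator b ∘ ν)   ≡⟨ sum-cong-≗ {n} (cong (indicator b) ∘ ν≗ν′) ⟩
  sum (indicator b ∘ ν′)  ≡⟨ count≡sum b ν′ ⟨
  count b ν′              ∎
  where open ≡-Reasoning

count-++ : ∀ b (x : Fin l → Bool) (y : Fin r → Bool) → count b (x ++ y) ≡ count b x + count b y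
count-++ {zero}      b x y = refl
count-++ {suc l} {r} b x y = begin
  x₀ + count b ((x ++ y) ∘ suc)           ≡⟨ cong (x₀ +_) (count-cong b shift) ⟩
  x₀ + count b ((x ∘ suc) ++ y)           ≡⟨ cong (x₀ +_) (count-++ b (x ∘ suc) y) ⟩
  x₀ + (count b (x ∘ suc) + count b y)    ≡⟨ +-assoc x₀ _ _ ⟨
  count b x + count b y                   ∎
  where
  open ≡-Reasoning
  x₀ : ℕ
  x₀ = indicator b (x zero)

  shift : ∀ i → (x ++ y) (suc i) ≡ ((x ∘ suc) ++ y) i
  shift i with splitAt l i
  ... | inj₁ _ = refl
  ... | inj₂ _ = refl

count-permute : ∀ b (π : Permutation′ n) (w : Fin n → Bool) → count b (w ∘ (π ⟨$⟩ˡ_)) ≡ count b w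
count-permute {n} b π w = begin
  count b (w ∘ (π ⟨$⟩ˡ_))                         ≡⟨ count≡sum b (w ∘ (π ⟨$⟩ˡ_)) ⟩
  sum (indicator b ∘ w ∘ (π ⟨$⟩ˡ_))               ≡⟨ sum-permute {n} (indicator b ∘ w ∘ (π ⟨$⟩ˡ_)) π ⟩
  sum (indicator b ∘ w ∘ (π ⟨$⟩ˡ_) ∘ (π ⟨$⟩ʳ_))  ≡⟨ sum-cong-≗ {n} (λ _ → cong (indicator b ∘ w) (inverseˡ π)) ⟩
  sum (indicator b ∘ w)                           ≡⟨ count≡sum b w ⟨
  count b w                                       ∎
  where open ≡-Reasoning

#₀+#₁≡n : (ν : Fin n → Bool) → #₀ ν + #₁ ν ≡ n
#₀+#₁≡n {zero}  ν = refl
#₀+#₁≡n {suc n} ν with ν zero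
... | false = cong suc (#₀+#₁≡n (ν ∘ suc))
... | true  = trans (+-suc _ _) (cong suc (#₀+#₁≡n (ν ∘ suc)))

prefix : ℕ → Fin n → Bool
prefix a j = toℕ j <ᵇ a

#₁-prefix : a ≤ n → #₁ {n} (prefix a) ≡ a
#₁-prefix {zero}  {n}     z≤n       = #₁-prefix₀ n
  where
  #₁-prefix₀ : ∀ n → #₁ {n} (prefix 0) ≡ 0
  #₁-prefix₀ zero    = refl
  #₁-prefix₀ (suc n) = #₁-prefix₀ n
#₁-prefix {suc a} {suc n} (s≤s a≤n) = cong suc (#₁-prefix a≤n)

m+m≡n+n⇒m≡n : m + m ≡ n + n → m ≡ n
m+m≡n+n⇒m≡n {zero}  {zero}  _ = refl
m+m≡n+n⇒m≡n {suc m} {suc n} e = cong suc (m+m≡n+n⇒m≡n (suc-injective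
  (trans (sym (+-suc m m)) (trans (suc-injective e) (+-suc n n)))))

balanced⇒#₁≡half : (ν : Fin (k + k) → Bool) → #₀ ν ≡ #₁ ν → #₁ ν ≡ k
balanced⇒#₁≡half ν #₀≡#₁ = m+m≡n+n⇒m≡n (trans (cong (_+ #₁ ν) (sym #₀≡#₁)) (#₀+#₁≡n ν))

#₁≡half⇒balanced : (ν : Fin (k + k) → Bool) → #₁ ν ≡ k → #₀ ν ≡ #₁ ν
#₁≡half⇒balanced {k} ν #₁≡k =
  trans (+-cancelʳ-≡ k (#₀ ν) k (trans (cong (#₀ ν +_) (sym #₁≡k)) (#₀+#₁≡n ν))) (sym #₁≡k)

NotO-unbalanced : (ν : Fin n → Bool) → #₀ ν ≢ #₁ ν → NotO n ν ≡ true
NotO-unbalanced ν #₀≢#₁ with #₀ ν ℕ.≟ #₁ ν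
... | yes #₀≡#₁ = contradiction #₀≡#₁ #₀≢#₁
... | no  _     = refl

NotO-balanced : (ν : Fin n → Bool) → #₀ ν ≡ #₁ ν → NotO n ν ≢ true
NotO-balanced ν #₀≡#₁ with #₀ ν ℕ.≟ #₁ ν
... | yes _     = λ ()
... | no #₀≢#₁ = contradiction #₀≡#₁ #₀≢#₁

¬¬-∀-Fin : {P : Fin n → Set} → (∀ i → ¬ ¬ P i) → ¬ ¬ (∀ i → P i)
¬¬-∀-Fin {zero}  ¬¬P ¬∀P = ¬∀P λ ()
¬¬-∀-Fin {suc n} ¬¬P ¬∀P = ¬¬P zero λ P₀ → ¬¬-∀-Fin (¬¬P ∘ suc) λ P₊ →
  ¬∀P λ { zero → P₀ ; (suc i) → P₊ i }

-- R need not be decidable: as the conclusion is, it may be derived from a doubly negated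
-- decision of every instance of R, which makes a ↦ R a an injection into Fin s → Fin 2.
separating⇒≤2^ : ∀ {t s} (R : Fin t → Fin s → Set) →
                 (∀ {a b} → a ≢ b → ∃[ v ] R a v × ¬ R b v) → t ≤ 2 ^ s
separating⇒≤2^ {t} {s} R separates = decidable-stable (t ≤? 2 ^ s) λ t≰2^s →
  ¬¬-∀-Fin (λ a → ¬¬-∀-Fin (λ v → ¬¬-excluded-middle)) (t≰2^s ∘ encode)
  where
  χ : ∀ {A : Set} → Dec A → Fin 2
  χ (yes _) = suc zero
  χ (no _)  = zero

  transfer : ∀ {A B : Set} (A? : Dec A) (B? : Dec B) → χ A? ≡ χ B? → A → B
  transfer (yes _) (yes b) _  _ = b
  transfer (yes _) (no _)  () _
  transfer (no ¬a) _       _  a = contradiction a ¬a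

  encode : (∀ a v → Dec (R a v)) → t ≤ 2 ^ s
  encode R? = injective⇒≤ {f = characteristic} injective
    where
    characteristic : Fin t → Fin (2 ^ s)
    characteristic a = funToFin (χ ∘ R? a)

    injective : ∀ {a b} → characteristic a ≡ characteristic b → a ≡ b
    injective {a} {b} eq with a Fin.≟ b
    ... | yes a≡b = a≡b
    ... | no  a≢b with separates a≢b
    ... | v , Rav , ¬Rbv = contradiction (transfer (R? a v) (R? b v) χ-eq Rav) ¬Rbv
      where
      χ-eq : χ (R? a v) ≡ χ (R? b v)
      χ-eq = trans (sym (finToFun-funToFin (χ ∘ R? a) v))
               (trans (cong (λ c → finToFun c v) eq) (finToFun-funToFin (χ ∘ R? b) v))

maxF-upper : ∀ t (f : Fin t → ℕ) i → f i ≤ maxF t f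
maxF-upper (suc t) f zero    = m≤m⊔n (f zero) _
maxF-upper (suc t) f (suc i) = ≤-trans (maxF-upper t (f ∘ suc) i) (m≤n⊔m (f zero) _)

module CutAndPaste {l r : ℕ} (B : NOBDD (l + r)) where
  open NOBDD B

  -- The input whose variables, in the order in which B reads them, spell x ++ y.
  input : (Fin l → Bool) → (Fin r → Bool) → Fin (l + r) → Bool
  input x y i = (x ++ y) (order ⟨$⟩ˡ i)

  cut : Fin (suc (l + r))
  cut = fromℕ< (s≤s (m≤m+n l r))

  toℕ-cut : toℕ cut ≡ l
  toℕ-cut = toℕ-fromℕ< (s≤s (m≤m+n l r))

  read-left : ∀ x y y′ {j} → toℕ j < l → input x y (order ⟨$⟩ʳ j) ≡ input x y′ (order ⟨$⟩ʳ j)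
  read-left x y y′ {j} j<l rewrite inverseˡ order {j} | splitAt-< l j j<l = refl

  read-right : ∀ x x′ y {j} → l ≤ toℕ j → input x y (order ⟨$⟩ʳ j) ≡ input x′ y (order ⟨$⟩ʳ j)
  read-right x x′ y {j} l≤j rewrite inverseˡ order {j} | splitAt-≥ l j l≤j = refl

  edge-cong : ∀ j {u u′ b b′ v v′} → u ≡ u′ → b ≡ b′ → v ≡ v′ →
              edge j u b v ≡ true → edge j u′ b′ v′ ≡ true
  edge-cong j refl refl refl e = e

  paste : ∀ {x y x′ y′} (p : Path (input x y)) (q : Path (input x′ y′)) →
          Path.node p cut ≡ Path.node q cut → accept (Path.node q (fromℕ (l + r))) ≡ true →
          Accepts (input x y′)
  paste {x} {y} {x′} {y′} p q p≡q q-accepts =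
    record { node = node ; start = trans (node-left zero z≤n) (Path.start p) ; steps = steps } ,
    trans (cong accept (node-right (fromℕ (l + r)) l≤end)) q-accepts
    where
    node : (j : Fin (suc (l + r))) → Fin (size j)
    node j with toℕ j ≤? l
    ... | yes _ = Path.node p j
    ... | no  _ = Path.node q j

    node-left : ∀ j → toℕ j ≤ l → node j ≡ Path.node p j
    node-left j j≤l with toℕ j ≤? l
    ... | yes _   = refl
    ... | no  j≰l = contradiction j≤l j≰l

    node-right : ∀ j → l ≤ toℕ j → node j ≡ Path.node q j
    node-right j l≤j with toℕ j ≤? l
    ... | no  _   = refl
    ... | yes j≤l rewrite toℕ-injective {i = j} {j = cut} (trans (≤-antisym j≤l l≤j) (sym toℕ-cut)) = p≡q

    l≤end : l ≤ toℕ (fromℕ (l + r))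
    l≤end = subst (l ≤_) (sym (toℕ-fromℕ (l + r))) (m≤m+n l r)

    Step : Fin (l + r) → Set
    Step j = edge j (node (inject₁ j)) (input x y′ (order ⟨$⟩ʳ j)) (node (suc j)) ≡ true

    -- Deciding toℕ j < l outside of a with-clause keeps node (suc j) from being abstracted.
    step : ∀ j → Dec (toℕ j < l) → Step j
    step j (yes j<l) = edge-cong j
      (sym (node-left (inject₁ j) (subst (_≤ l) (sym (toℕ-inject₁ j)) (<⇒≤ j<l))))
      (read-left x y y′ j<l)
      (sym (node-left (suc j) j<l))
      (Path.steps p j)
    step j (no j≮l) = edge-cong j
      (sym (node-right (inject₁ j) (subst (l ≤_) (sym (toℕ-inject₁ j)) (≮⇒≥ j≮l))))
      (read-right x′ x y′ (≮⇒≥ j≮l))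
      (sym (node-right (suc j) (m≤n⇒m≤1+n (≮⇒≥ j≮l))))
      (Path.steps q j)

    steps : ∀ j → Step j
    steps j = step j (toℕ j <? l)

module FoolingSet {k : ℕ} (B : NOBDD (k + k)) (computes : NOBDD.Computes B (NotO (k + k))) where
  open NOBDD B
  open CutAndPaste {k} {k} B

  fool : Fin (suc k) → Fin (suc k) → Fin (k + k) → Bool
  fool a b = input (prefix (toℕ a)) (prefix (k ∸ toℕ b))

  #₁-fool : ∀ a b → #₁ (fool a b) ≡ toℕ a + (k ∸ toℕ b)
  #₁-fool a b = begin
    #₁ (fool a b)                                  ≡⟨ count-permute true order (x ++ y) ⟩
    #₁ (x ++ y)                                    ≡⟨ count-++ true x y ⟩
    #₁ x + #₁ y                                    ≡⟨ cong₂ _+_ (#₁-prefix (toℕ≤pred[n] a)) (#₁-prefix (m∸n≤m k (toℕ b))) ⟩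
    toℕ a + (k ∸ toℕ b)                            ∎
    where
    open ≡-Reasoning
    x y : Fin k → Bool
    x = prefix (toℕ a)
    y = prefix (k ∸ toℕ b)

  fool-balanced⇒≡ : ∀ a b → #₀ (fool a b) ≡ #₁ (fool a b) → a ≡ b
  fool-balanced⇒≡ a b balanced = toℕ-injective (+-cancelʳ-≡ (k ∸ toℕ b) (toℕ a) (toℕ b) (begin
    toℕ a + (k ∸ toℕ b)  ≡⟨ #₁-fool a b ⟨
    #₁ (fool a b)        ≡⟨ balanced⇒#₁≡half (fool a b) balanced ⟩
    k                    ≡⟨ m+[n∸m]≡n (toℕ≤pred[n] b) ⟨
    toℕ b + (k ∸ toℕ b)  ∎))
    where open ≡-Reasoning

  fool-diagonal-balanced : ∀ a → #₀ (fool a a) ≡ #₁ (fool a a)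
  fool-diagonal-balanced a =
    #₁≡half⇒balanced (fool a a) (trans (#₁-fool a a) (m+[n∸m]≡n (toℕ≤pred[n] a)))

  AcceptedThrough : Fin (suc k) → Fin (size cut) → Set
  AcceptedThrough a v = ∃[ b ] Σ (Path (fool a b)) λ p →
    accept (Path.node p (fromℕ (k + k))) ≡ true × Path.node p cut ≡ v

  separates : ∀ {a b} → a ≢ b → ∃[ v ] AcceptedThrough a v × ¬ AcceptedThrough b v
  separates {a} {b} a≢b with Equivalence.from (computes (fool a b))
                               (NotO-unbalanced (fool a b) (a≢b ∘ fool-balanced⇒≡ a b))
  ... | p , p-accepts = Path.node p cut , (b , p , p-accepts , refl) , λ (_ , q , _ , q≡p) →
    NotO-balanced (fool b b) (fool-diagonal-balanced b)
      (Equivalence.to (computes (fool b b)) (paste q p q≡p p-accepts))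

  suc≤2^width : suc k ≤ 2 ^ width
  suc≤2^width = ≤-trans (separating⇒≤2^ AcceptedThrough separates)
                        (^-monoʳ-≤ 2 (maxF-upper (suc (k + k)) size cut))

n<2^n : ∀ n → n < 2 ^ n
n<2^n zero    = s≤s z≤n
n<2^n (suc n) = ≤-trans (s≤s (n<2^n n)) (+-mono-≤ (m^n>0 2 n) (m≤m+n (2 ^ n) 0))

2^-cancel-< : 2 ^ m < 2 ^ n → m < n
2^-cancel-< {m} {n} 2^m<2^n with m <? n
... | yes m<n = m<n
... | no  m≮n = contradiction 2^m<2^n (≤⇒≯ (^-monoʳ-≤ 2 (≮⇒≥ m≮n)))

theorem6 : (m : ℕ) → Σ ℕ (λ n → m ≤ n × ((B : NOBDD n) → NOBDD.Computes B (NotO n) → ⌊log₂ n ⌋ ∸ 1 ≤ NOBDD.width B))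
theorem6 m = 2 ^ m + 2 ^ m , ≤-trans (<⇒≤ (n<2^n m)) (m≤m+n (2 ^ m) (2 ^ m)) , λ B computes →
  subst (_≤ NOBDD.width B) (sym ⌊log₂n⌋∸1≡m)
    (<⇒≤ (2^-cancel-< (FoolingSet.suc≤2^width B computes)))
  where
  ⌊log₂n⌋∸1≡m : ⌊log₂ (2 ^ m + 2 ^ m) ⌋ ∸ 1 ≡ m
  ⌊log₂n⌋∸1≡m = cong (_∸ 1) (trans (cong (λ n → ⌊log₂ 2 ^ m + n ⌋) (sym (+-identityʳ (2 ^ m))))
                                     (⌊log₂[2^n]⌋≡n (suc m)))
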